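{- Let $(S,\leq)$ be an ordered set. \begin{enumerate} \item Two distinct inclusion-maximal isolated suborders with bottleneck of $(S,\leq)$ are disjoint. \item For every maximal element $s$ of $S$, there is at most one nontrivial inclusion-maximal summit isolated suborder of $(S,\leq)$ with $s$ as greatest element. \end{enumerate}
   Context: A subset $S'\subseteq S$ is an isolated suborder if (1) $S'$ has a greatest element $\top_{S'}$ and a least element $\bot_{S'}$; (2) for all $x\notin S'$ and $y'\in S'$, $y'\leq x$ implies $\top_{S'}\leq x$; (3) for all $x\notin S'$ and $y'\in S'$, $x\leq y'$ implies $x\leq\bot_{S'}$. It is nontrivial if $S'\neq S$, and summit if $\top_{S'}$ is a maximal element of $S$. An element $b$ is a bottleneck of $x$ if $b>x$, the interval $[x,b]$ is a chain, and for all $y\in S$, $y>x$ implies $y\in[x,b]$ or $y>b$. An isolated suborder with bottleneck is an isolated suborder $S'$ such that $\top_{S'}$ has a bottleneck. -}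

module Defs where

open import Level using (Level; _⊔_)
open import Data.Product using (Σ; _×_; ∃-syntax)
open import Data.Sum using (_⊎_)
open import Relation.Nullary using (¬_)
open import Relation.Unary using (Pred; _∈_; _∉_; _⊆_)
open import Relation.Binary using (Rel)
open import Relation.Binary.PropositionalEquality using (_≡_; _≢_)

module Order {a ℓ : Level} {A : Set a} (_≤_ : Rel A ℓ) where

  _<_ : A → A → Set (a ⊔ ℓ)
  x < y = (x ≤ y) × (x ≢ y)

  Maximal : A → Set (a ⊔ ℓ)
  Maximal m = ∀ y → m ≤ y → y ≡ m

  Interval : A → A → Pred A ℓ
  Interval x b y = (x ≤ y) × (y ≤ b)

  IsChain : ∀ {r} → Pred A r → Set (a ⊔ ℓ ⊔ r)
  IsChain P = ∀ y z → y ∈ P → z ∈ P → (y ≤ z) ⊎ (z ≤ y)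

  Bottleneck : A → A → Set (a ⊔ ℓ)
  Bottleneck x b =
    (x < b) × IsChain (Interval x b) × (∀ y → x < y → (y ∈ Interval x b) ⊎ (b < y))

  IsGreatest : ∀ {r} → Pred A r → A → Set (a ⊔ ℓ ⊔ r)
  IsGreatest S' t = (t ∈ S') × (∀ y → y ∈ S' → y ≤ t)

  IsLeast : ∀ {r} → Pred A r → A → Set (a ⊔ ℓ ⊔ r)
  IsLeast S' u = (u ∈ S') × (∀ y → y ∈ S' → u ≤ y)

  IsIsolatedWith : ∀ {r} → Pred A r → A → A → Set (a ⊔ ℓ ⊔ r)
  IsIsolatedWith S' t u =
    IsGreatest S' t × IsLeast S' u
    × (∀ x y → x ∉ S' → y ∈ S' → y ≤ x → t ≤ x)
    × (∀ x y → x ∉ S' → y ∈ S' → x ≤ y → x ≤ u)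

  IsolatedSuborder : ∀ {r} → Pred A r → Set (a ⊔ ℓ ⊔ r)
  IsolatedSuborder S' = ∃[ t ] ∃[ u ] IsIsolatedWith S' t u

  Nontrivial : ∀ {r} → Pred A r → Set (a ⊔ r)
  Nontrivial S' = ¬ (∀ x → x ∈ S')

  SummitIsolatedWithTop : ∀ {r} → Pred A r → A → Set (a ⊔ ℓ ⊔ r)
  SummitIsolatedWithTop S' s = Maximal s × (∃[ u ] IsIsolatedWith S' s u)

  SummitIsolated : ∀ {r} → Pred A r → Set (a ⊔ ℓ ⊔ r)
  SummitIsolated S' = ∃[ s ] SummitIsolatedWithTop S' s

  IsolatedWithBottleneck : ∀ {r} → Pred A r → Set (a ⊔ ℓ ⊔ r)
  IsolatedWithBottleneck S' =
    ∃[ t ] ∃[ u ] (IsIsolatedWith S' t u × ∃[ b ] Bottleneck t b)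

  InclusionMaximal : ∀ {r p} → (Pred A r → Set p) → Pred A r → Set (a ⊔ p Level.⊔ Level.suc r)
  InclusionMaximal Φ S' = Φ S' × (∀ T → Φ T → S' ⊆ T → T ⊆ S')

  SameSubset : ∀ {r} → Pred A r → Pred A r → Set (a ⊔ r)
  SameSubset S₁ S₂ = (S₁ ⊆ S₂) × (S₂ ⊆ S₁)

  Disjoint : ∀ {r} → Pred A r → Pred A r → Set (a ⊔ r)
  Disjoint S₁ S₂ = ∀ x → ¬ ((x ∈ S₁) × (x ∈ S₂))

{-# OPTIONS --safe #-}
-- Two isolated suborders that share an element have an isolated union, whose greatest
-- element is one of the two greatest elements and whose least element is one of the two
-- least elements. Hence each of the two families is closed under unions of members that
-- meet, and inclusion-maximality forces two meeting members to coincide with their union.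
module Submission where

open import Defs
open import Level using (Level; _⊔_; Lift; lift; lower)
open import Relation.Nullary using (¬_; Dec; yes; no)
open import Relation.Nullary.Decidable using (map′)
open import Data.Product using (_×_; _,_; proj₁; proj₂; ∃-syntax)
open import Data.Sum using (_⊎_; inj₁; inj₂)
open import Relation.Unary using (Pred; _∈_; _∉_; _∪_)
open import Relation.Binary using (Rel; IsPartialOrder)
open import Relation.Binary.PropositionalEquality using (_≡_; subst; sym)
open import Axiom.ExcludedMiddle using (ExcludedMiddle)

module IsolatedSuborders {a ℓ r : Level} {A : Set a} {_≤_ : Rel A ℓ}
                         (po : IsPartialOrder _≡_ _≤_) (em : ExcludedMiddle (a ⊔ ℓ ⊔ r)) where
  open Order _≤_
  open IsPartialOrder po using (trans)

  decide : (P : Set r) → Dec P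
  decide P = map′ lower lift (em {Lift (a ⊔ ℓ) P})

  maximal-closed-under-∪⇒same : ∀ {p} {Φ : Pred A r → Set p} {S₁ S₂ : Pred A r}
    → InclusionMaximal Φ S₁ → InclusionMaximal Φ S₂ → Φ (S₁ ∪ S₂) → SameSubset S₁ S₂
  maximal-closed-under-∪⇒same (_ , max₁) (_ , max₂) Φ∪ =
    (λ x∈S₁ → max₂ _ Φ∪ inj₂ (inj₁ x∈S₁)) , (λ x∈S₂ → max₁ _ Φ∪ inj₁ (inj₂ x∈S₂))

  summit-with-global-bottom⇒full : ∀ {S : Pred A r} {t u : A} → Maximal t
    → IsIsolatedWith S t u → (∀ x → u ≤ x) → ∀ x → x ∈ S
  summit-with-global-bottom⇒full {S} max-t ((t∈S , _) , (u∈S , _) , up , _) u≤ x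
    with decide (x ∈ S)
  ... | yes x∈S = x∈S
  ... | no  x∉S = subst S (sym (max-t x (up x _ x∉S u∈S (u≤ x)))) t∈S

  module _ {S₁ S₂ : Pred A r} {t₁ u₁ t₂ u₂ : A}
           (I₁ : IsIsolatedWith S₁ t₁ u₁) (I₂ : IsIsolatedWith S₂ t₂ u₂)
           {w : A} (w∈S₁ : w ∈ S₁) (w∈S₂ : w ∈ S₂) where

    private
      t₁∈S₁ : t₁ ∈ S₁
      t₁∈S₁ = proj₁ (proj₁ I₁)
      t₂∈S₂ : t₂ ∈ S₂
      t₂∈S₂ = proj₁ (proj₁ I₂)
      ≤t₁ : ∀ y → y ∈ S₁ → y ≤ t₁
      ≤t₁ = proj₂ (proj₁ I₁)
      ≤t₂ : ∀ y → y ∈ S₂ → y ≤ t₂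
      ≤t₂ = proj₂ (proj₁ I₂)
      u₁∈S₁ : u₁ ∈ S₁
      u₁∈S₁ = proj₁ (proj₁ (proj₂ I₁))
      u₂∈S₂ : u₂ ∈ S₂
      u₂∈S₂ = proj₁ (proj₁ (proj₂ I₂))
      u₁≤ : ∀ y → y ∈ S₁ → u₁ ≤ y
      u₁≤ = proj₂ (proj₁ (proj₂ I₁))
      u₂≤ : ∀ y → y ∈ S₂ → u₂ ≤ y
      u₂≤ = proj₂ (proj₁ (proj₂ I₂))
      up₁ : ∀ x y → x ∉ S₁ → y ∈ S₁ → y ≤ x → t₁ ≤ x
      up₁ = proj₁ (proj₂ (proj₂ I₁))
      up₂ : ∀ x y → x ∉ S₂ → y ∈ S₂ → y ≤ x → t₂ ≤ x
      up₂ = proj₁ (proj₂ (proj₂ I₂))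
      down₁ : ∀ x y → x ∉ S₁ → y ∈ S₁ → x ≤ y → x ≤ u₁
      down₁ = proj₂ (proj₂ (proj₂ I₁))
      down₂ : ∀ x y → x ∉ S₂ → y ∈ S₂ → x ≤ y → x ≤ u₂
      down₂ = proj₂ (proj₂ (proj₂ I₂))

    -- Whatever lies above an element of S₁ ∪ S₂ lies above w, which is in both.
    ∪-above⇒above-tops : ∀ x y → x ∉ S₁ → x ∉ S₂ → y ∈ S₁ ∪ S₂ → y ≤ x
      → (t₁ ≤ x) × (t₂ ≤ x)
    ∪-above⇒above-tops x y x∉S₁ x∉S₂ (inj₁ y∈S₁) y≤x =
      t₁≤x , up₂ x w x∉S₂ w∈S₂ (trans (≤t₁ w w∈S₁) t₁≤x)
      where t₁≤x : t₁ ≤ x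
            t₁≤x = up₁ x y x∉S₁ y∈S₁ y≤x
    ∪-above⇒above-tops x y x∉S₁ x∉S₂ (inj₂ y∈S₂) y≤x =
      up₁ x w x∉S₁ w∈S₁ (trans (≤t₂ w w∈S₂) t₂≤x) , t₂≤x
      where t₂≤x : t₂ ≤ x
            t₂≤x = up₂ x y x∉S₂ y∈S₂ y≤x

    ∪-below⇒below-bottoms : ∀ x y → x ∉ S₁ → x ∉ S₂ → y ∈ S₁ ∪ S₂ → x ≤ y
      → (x ≤ u₁) × (x ≤ u₂)
    ∪-below⇒below-bottoms x y x∉S₁ x∉S₂ (inj₁ y∈S₁) x≤y =
      x≤u₁ , down₂ x w x∉S₂ w∈S₂ (trans x≤u₁ (u₁≤ w w∈S₁))
      where x≤u₁ : x ≤ u₁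
            x≤u₁ = down₁ x y x∉S₁ y∈S₁ x≤y
    ∪-below⇒below-bottoms x y x∉S₁ x∉S₂ (inj₂ y∈S₂) x≤y =
      down₁ x w x∉S₁ w∈S₁ (trans x≤u₂ (u₂≤ w w∈S₂)) , x≤u₂
      where x≤u₂ : x ≤ u₂
            x≤u₂ = down₂ x y x∉S₂ y∈S₂ x≤y

    ∪-greatest : IsGreatest (S₁ ∪ S₂) t₁ ⊎ IsGreatest (S₁ ∪ S₂) t₂
    ∪-greatest with decide (t₁ ∈ S₂)
    ... | yes t₁∈S₂ = inj₂ (inj₂ t₂∈S₂ , ≤t₂′)
      where ≤t₂′ : ∀ y → y ∈ S₁ ∪ S₂ → y ≤ t₂
            ≤t₂′ y (inj₁ y∈S₁) = trans (≤t₁ y y∈S₁) (≤t₂ t₁ t₁∈S₂)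
            ≤t₂′ y (inj₂ y∈S₂) = ≤t₂ y y∈S₂
    ... | no t₁∉S₂ = inj₁ (inj₁ t₁∈S₁ , ≤t₁′)
      where ≤t₁′ : ∀ y → y ∈ S₁ ∪ S₂ → y ≤ t₁
            ≤t₁′ y (inj₁ y∈S₁) = ≤t₁ y y∈S₁
            ≤t₁′ y (inj₂ y∈S₂) = trans (≤t₂ y y∈S₂) (up₂ t₁ w t₁∉S₂ w∈S₂ (≤t₁ w w∈S₁))

    ∪-least : IsLeast (S₁ ∪ S₂) u₁ ⊎ IsLeast (S₁ ∪ S₂) u₂
    ∪-least with decide (u₁ ∈ S₂)
    ... | yes u₁∈S₂ = inj₂ (inj₂ u₂∈S₂ , u₂≤′)
      where u₂≤′ : ∀ y → y ∈ S₁ ∪ S₂ → u₂ ≤ y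
            u₂≤′ y (inj₁ y∈S₁) = trans (u₂≤ u₁ u₁∈S₂) (u₁≤ y y∈S₁)
            u₂≤′ y (inj₂ y∈S₂) = u₂≤ y y∈S₂
    ... | no u₁∉S₂ = inj₁ (inj₁ u₁∈S₁ , u₁≤′)
      where u₁≤′ : ∀ y → y ∈ S₁ ∪ S₂ → u₁ ≤ y
            u₁≤′ y (inj₁ y∈S₁) = u₁≤ y y∈S₁
            u₁≤′ y (inj₂ y∈S₂) = trans (down₂ u₁ w u₁∉S₂ w∈S₂ (u₁≤ w w∈S₁)) (u₂≤ y y∈S₂)

    ∪-member-below : ∀ {t x} → t ∈ S₁ ∪ S₂ → (t₁ ≤ x) × (t₂ ≤ x) → t ≤ x
    ∪-member-below (inj₁ t∈S₁) (t₁≤x , _) = trans (≤t₁ _ t∈S₁) t₁≤x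
    ∪-member-below (inj₂ t∈S₂) (_ , t₂≤x) = trans (≤t₂ _ t∈S₂) t₂≤x

    ∪-member-above : ∀ {u x} → u ∈ S₁ ∪ S₂ → (x ≤ u₁) × (x ≤ u₂) → x ≤ u
    ∪-member-above (inj₁ u∈S₁) (x≤u₁ , _) = trans x≤u₁ (u₁≤ _ u∈S₁)
    ∪-member-above (inj₂ u∈S₂) (_ , x≤u₂) = trans x≤u₂ (u₂≤ _ u∈S₂)

    ∪-isolated : ∀ {t u} → IsGreatest (S₁ ∪ S₂) t → IsLeast (S₁ ∪ S₂) u
      → IsIsolatedWith (S₁ ∪ S₂) t u
    ∪-isolated greatest@(t∈ , _) least@(u∈ , _) =
      greatest , least
      , (λ x y x∉ y∈ y≤x → ∪-member-below t∈
           (∪-above⇒above-tops x y (λ p → x∉ (inj₁ p)) (λ p → x∉ (inj₂ p)) y∈ y≤x))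
      , (λ x y x∉ y∈ x≤y → ∪-member-above u∈
           (∪-below⇒below-bottoms x y (λ p → x∉ (inj₁ p)) (λ p → x∉ (inj₂ p)) y∈ x≤y))

    ∪-isolatedAt : ∀ {t} → IsGreatest (S₁ ∪ S₂) t → ∃[ u ] IsIsolatedWith (S₁ ∪ S₂) t u
    ∪-isolatedAt greatest with ∪-least
    ... | inj₁ least = u₁ , ∪-isolated greatest least
    ... | inj₂ least = u₂ , ∪-isolated greatest least

    ∪-nontrivial : Maximal t₁ → Maximal t₂ → Nontrivial S₁ → Nontrivial S₂
      → Nontrivial (S₁ ∪ S₂)
    ∪-nontrivial max-t₁ max-t₂ nontriv₁ nontriv₂ full with ∪-least
    ... | inj₁ (_ , u₁≤′) = nontriv₁ (summit-with-global-bottom⇒full max-t₁ I₁ (λ x → u₁≤′ x (full x)))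
    ... | inj₂ (_ , u₂≤′) = nontriv₂ (summit-with-global-bottom⇒full max-t₂ I₂ (λ x → u₂≤′ x (full x)))

  module _ {S₁ S₂ : Pred A r} {w : A} (w∈S₁ : w ∈ S₁) (w∈S₂ : w ∈ S₂) where

    ∪-isolatedWithBottleneck : IsolatedWithBottleneck S₁ → IsolatedWithBottleneck S₂
      → IsolatedWithBottleneck (S₁ ∪ S₂)
    ∪-isolatedWithBottleneck (t₁ , u₁ , I₁ , bn₁) (t₂ , u₂ , I₂ , bn₂)
      with ∪-greatest I₁ I₂ w∈S₁ w∈S₂
    ... | inj₁ greatest = let u , I = ∪-isolatedAt I₁ I₂ w∈S₁ w∈S₂ greatest in t₁ , u , I , bn₁
    ... | inj₂ greatest = let u , I = ∪-isolatedAt I₁ I₂ w∈S₁ w∈S₂ greatest in t₂ , u , I , bn₂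

    ∪-nontrivialSummit : Nontrivial S₁ × SummitIsolated S₁ → Nontrivial S₂ × SummitIsolated S₂
      → Nontrivial (S₁ ∪ S₂) × SummitIsolated (S₁ ∪ S₂)
    ∪-nontrivialSummit (nontriv₁ , t₁ , max-t₁ , u₁ , I₁) (nontriv₂ , t₂ , max-t₂ , u₂ , I₂) =
      ∪-nontrivial I₁ I₂ w∈S₁ w∈S₂ max-t₁ max-t₂ nontriv₁ nontriv₂ , summit
      where
        summit : SummitIsolated (S₁ ∪ S₂)
        summit with ∪-greatest I₁ I₂ w∈S₁ w∈S₂
        ... | inj₁ greatest = t₁ , max-t₁ , ∪-isolatedAt I₁ I₂ w∈S₁ w∈S₂ greatest
        ... | inj₂ greatest = t₂ , max-t₂ , ∪-isolatedAt I₁ I₂ w∈S₁ w∈S₂ greatest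

  maximal-isolatedWithBottleneck-disjoint : ∀ {S₁ S₂ : Pred A r}
    → InclusionMaximal IsolatedWithBottleneck S₁ → InclusionMaximal IsolatedWithBottleneck S₂
    → ¬ SameSubset S₁ S₂ → Disjoint S₁ S₂
  maximal-isolatedWithBottleneck-disjoint max₁ max₂ distinct w (w∈S₁ , w∈S₂) =
    distinct (maximal-closed-under-∪⇒same max₁ max₂
      (∪-isolatedWithBottleneck w∈S₁ w∈S₂ (proj₁ max₁) (proj₁ max₂)))

  maximal-nontrivialSummit-sharing⇒same : ∀ {S₁ S₂ : Pred A r} {w : A}
    → InclusionMaximal (λ T → Nontrivial T × SummitIsolated T) S₁
    → InclusionMaximal (λ T → Nontrivial T × SummitIsolated T) S₂
    → w ∈ S₁ → w ∈ S₂ → SameSubset S₁ S₂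
  maximal-nontrivialSummit-sharing⇒same max₁ max₂ w∈S₁ w∈S₂ =
    maximal-closed-under-∪⇒same max₁ max₂
      (∪-nontrivialSummit w∈S₁ w∈S₂ (proj₁ max₁) (proj₁ max₂))

theorem4p7 : {a ℓ r : Level} (A : Set a) (_≤_ : Rel A ℓ) → IsPartialOrder _≡_ _≤_
             → ExcludedMiddle (a ⊔ ℓ ⊔ r)
             → let open Order _≤_ in
               (∀ (S₁ S₂ : Pred A r)
                  → InclusionMaximal IsolatedWithBottleneck S₁
                  → InclusionMaximal IsolatedWithBottleneck S₂
                  → ¬ SameSubset S₁ S₂
                  → Disjoint S₁ S₂)
               × (∀ (s : A) → Maximal s → ∀ (S₁ S₂ : Pred A r)
                  → InclusionMaximal (λ T → Nontrivial T × SummitIsolated T) S₁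
                  → InclusionMaximal (λ T → Nontrivial T × SummitIsolated T) S₂
                  → IsGreatest S₁ s
                  → IsGreatest S₂ s
                  → SameSubset S₁ S₂)
theorem4p7 {r = r} A _≤_ po em =
  (λ _ _ → maximal-isolatedWithBottleneck-disjoint)
  , λ s _ _ _ max₁ max₂ (s∈S₁ , _) (s∈S₂ , _) →
      maximal-nontrivialSummit-sharing⇒same max₁ max₂ s∈S₁ s∈S₂
  where open IsolatedSuborders {r = r} po em
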